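{- Let $R$ be a p.q.-Baer $*$-ring and let $a$ be a cut vertex of $\Gamma^*_s(R)$. Then $a$ is a central projection of $R$ and $a$ is an atom in the lattice $L(CP(R))$ of central projections of $R$.
   Context: A $*$-ring is a ring $R$ with an involution $x\mapsto x^*$. A projection is an element $e$ with $e^2=e=e^*$; a central projection is a projection in the centre of $R$, and $CP(R)$ is the set of them. $CP(R)$ is a lattice under $e\leq f$ iff $e=ef=fe$, with $e\wedge f=ef$, $e\vee f=e+f-ef$; an atom is a nonzero $e$ such that $0\leq f\leq e$ implies $f=0$ or $f=e$. For $S\subseteq R$, $r_R(S)=\{x\in R: sx=0\ \forall s\in S\}$. $R$ is a p.q.-Baer $*$-ring if for every $a\in R$, $r_R(aR)=eR$ for some projection $e\in R$. The strong zero-divisor graph $\Gamma^*_s(R)$ is the simple undirected graph with vertex set $\{0\neq a\in R: r_R(aR)\neq\{0\}\}$, distinct vertices $a,b$ adjacent iff $aRb^*=0$. A cut vertex is a vertex whose removal increases the number of connected components. -}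

module Defs where

open import Level using (Level; _⊔_; suc)
open import Algebra.Bundles using (Ring)
open import Data.Product using (Σ; ∃; _×_; _,_)
open import Data.Sum using (_⊎_)
open import Relation.Nullary using (¬_)

record StarRing (c ℓ : Level) : Set (suc (c ⊔ ℓ)) where
  field
    ring : Ring c ℓ
  open Ring ring public
  field
    _⋆      : Carrier → Carrier
    ⋆-cong  : ∀ {x y} → x ≈ y → (x ⋆) ≈ (y ⋆)
    ⋆-invol : ∀ x → ((x ⋆) ⋆) ≈ x
    ⋆-+     : ∀ x y → ((x + y) ⋆) ≈ ((x ⋆) + (y ⋆))
    ⋆-*     : ∀ x y → ((x * y) ⋆) ≈ ((y ⋆) * (x ⋆))

module _ {c ℓ : Level} (R : StarRing c ℓ) where
  open StarRing R

  IsProjection : Carrier → Set ℓ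
  IsProjection e = (e * e ≈ e) × ((e ⋆) ≈ e)

  IsCentralProjection : Carrier → Set (c ⊔ ℓ)
  IsCentralProjection e = IsProjection e × (∀ x → e * x ≈ x * e)

  _≤CP_ : Carrier → Carrier → Set ℓ
  e ≤CP f = (e ≈ e * f) × (e ≈ f * e)

  IsAtomCP : Carrier → Set (c ⊔ ℓ)
  IsAtomCP e = IsCentralProjection e × (¬ (e ≈ 0#)) ×
    (∀ f → IsCentralProjection f → f ≤CP e → (f ≈ 0#) ⊎ (f ≈ e))

  InRightAnnOfIdeal : Carrier → Carrier → Set (c ⊔ ℓ)
  InRightAnnOfIdeal a x = ∀ r → (a * r) * x ≈ 0#

  -- p.q.-Baer *-ring: r_R(aR) = eR for some projection e
  IsPQBaer : Set (c ⊔ ℓ)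
  IsPQBaer = ∀ a → Σ Carrier λ e → IsProjection e ×
    (∀ x → (InRightAnnOfIdeal a x → Σ Carrier λ y → x ≈ e * y)
         × (Σ Carrier (λ y → x ≈ e * y) → InRightAnnOfIdeal a x))

  -- vertices of Γ*_s(R): a ≠ 0 with r_R(aR) ≠ {0}
  IsVertex : Carrier → Set (c ⊔ ℓ)
  IsVertex a = (¬ (a ≈ 0#)) × (Σ Carrier λ x → (¬ (x ≈ 0#)) × InRightAnnOfIdeal a x)

  -- adjacency in Γ*_s(R): distinct vertices with aRb* = 0
  Adjacent : Carrier → Carrier → Set (c ⊔ ℓ)
  Adjacent a b = IsVertex a × IsVertex b × (¬ (a ≈ b)) × (∀ r → (a * r) * (b ⋆) ≈ 0#)

  -- walks in Γ*_s(R) all of whose vertices satisfy P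
  -- (P = "is a vertex other than z" gives walks in Γ*_s(R) − z)
  data WalkIn (P : Carrier → Set (c ⊔ ℓ)) : Carrier → Carrier → Set (c ⊔ ℓ) where
    nil  : ∀ {x y} → P x → x ≈ y → WalkIn P x y
    cons : ∀ {x y z} → P x → Adjacent x y → WalkIn P y z → WalkIn P x z

  VertexExcept : Carrier → Carrier → Set (c ⊔ ℓ)
  VertexExcept a x = IsVertex x × (¬ (x ≈ a))

  -- cut vertex: removing a disconnects two vertices u, w (≠ a) that were
  -- connected in Γ*_s(R), i.e. a's component splits.
  IsCutVertex : Carrier → Set (c ⊔ ℓ)
  IsCutVertex a = IsVertex a × (Σ Carrier λ u → Σ Carrier λ w →
    VertexExcept a u × VertexExcept a w ×
    WalkIn IsVertex u w × ¬ (WalkIn (VertexExcept a) u w))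

{-# OPTIONS --safe #-}
-- Let p, q be the neighbours of a on either side of the cut, and let e, f be
-- the projections with r(pR) = eR and r(qR) = fR.  In a p.q.-Baer *-ring such
-- projections are central, so g = ef is a central projection, and g ≠ 0 because
-- it fixes a*.  Every nonzero self-adjoint h ≤ g is adjacent to both p and q,
-- so p — h — q would reconnect p and q in Γ*_s(R) − a unless h = a.  Taking
-- h = g gives a = g, and then every nonzero central projection below a is a.
module Submission where

open import Defs
open import Level using (_⊔_; Lift; lift; lower)
open import Data.Product using (Σ; _×_; _,_; proj₁; proj₂)
open import Data.Sum using (_⊎_; inj₁; inj₂)
open import Data.Empty using (⊥-elim)
open import Relation.Nullary using (¬_; Dec; yes; no)
open import Relation.Nullary.Decidable using (map′)
open import Axiom.ExcludedMiddle using (ExcludedMiddle)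

module _ {c ℓ} (R : StarRing c ℓ) where
  open StarRing R
  open import Relation.Binary.Reasoning.Setoid setoid

  ⋆-zero : (0# ⋆) ≈ 0#
  ⋆-zero = begin
    0# ⋆                    ≈⟨ ⋆-cong (sym (zeroʳ (0# ⋆))) ⟩
    (0# ⋆ * 0#) ⋆           ≈⟨ ⋆-* (0# ⋆) 0# ⟩
    (0# ⋆) * ((0# ⋆) ⋆)     ≈⟨ *-congˡ (⋆-invol 0#) ⟩
    (0# ⋆) * 0#             ≈⟨ zeroʳ (0# ⋆) ⟩
    0#                      ∎

  ⋆-≉0 : ∀ {x} → ¬ x ≈ 0# → ¬ (x ⋆) ≈ 0#
  ⋆-≉0 {x} x≉0 x⋆≈0 = x≉0 (trans (sym (⋆-invol x)) (trans (⋆-cong x⋆≈0) ⋆-zero))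

  infix 4 _⟂_
  _⟂_ : Carrier → Carrier → Set (c ⊔ ℓ)
  x ⟂ y = ∀ r → (x * r) * (y ⋆) ≈ 0#

  ⟂-sym : ∀ {x y} → x ⟂ y → y ⟂ x
  ⟂-sym {x} {y} x⟂y r = begin
    (y * r) * (x ⋆)                       ≈⟨ *-assoc y r (x ⋆) ⟩
    y * (r * (x ⋆))                       ≈⟨ *-cong (sym (⋆-invol y)) (*-congʳ (sym (⋆-invol r))) ⟩
    ((y ⋆) ⋆) * (((r ⋆) ⋆) * (x ⋆))       ≈⟨ *-congˡ (sym (⋆-* x (r ⋆))) ⟩
    ((y ⋆) ⋆) * ((x * (r ⋆)) ⋆)           ≈⟨ sym (⋆-* (x * (r ⋆)) (y ⋆)) ⟩
    ((x * (r ⋆)) * (y ⋆)) ⋆               ≈⟨ ⋆-cong (x⟂y (r ⋆)) ⟩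
    0# ⋆                                  ≈⟨ ⋆-zero ⟩
    0#                                    ∎

  ⟂-congˡ : ∀ {x x′ y} → x ≈ x′ → x ⟂ y → x′ ⟂ y
  ⟂-congˡ x≈x′ x⟂y r = trans (*-congʳ (*-congʳ (sym x≈x′))) (x⟂y r)

  ⟂-congʳ : ∀ {x y y′} → y ≈ y′ → x ⟂ y → x ⟂ y′
  ⟂-congʳ y≈y′ x⟂y r = trans (*-congˡ (⋆-cong (sym y≈y′))) (x⟂y r)

  ⟂⇒IsVertex : ∀ {x y} → ¬ x ≈ 0# → ¬ y ≈ 0# → x ⟂ y → IsVertex R x
  ⟂⇒IsVertex x≉0 y≉0 x⟂y = x≉0 , _ , ⋆-≉0 y≉0 , x⟂y

  ⟂⇒Adjacent : ∀ {x y} → ¬ x ≈ 0# → ¬ y ≈ 0# → ¬ x ≈ y → x ⟂ y → Adjacent R x y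
  ⟂⇒Adjacent x≉0 y≉0 x≉y x⟂y =
    ⟂⇒IsVertex x≉0 y≉0 x⟂y , ⟂⇒IsVertex y≉0 x≉0 (⟂-sym x⟂y) , x≉y , x⟂y

  Adjacent-sym : ∀ {x y} → Adjacent R x y → Adjacent R y x
  Adjacent-sym (vx , vy , x≉y , x⟂y) = vy , vx , (λ y≈x → x≉y (sym y≈x)) , ⟂-sym x⟂y

  IsVertex-cong : ∀ {x x′} → x ≈ x′ → IsVertex R x → IsVertex R x′
  IsVertex-cong x≈x′ (x≉0 , y , y≉0 , x⟂y) =
    (λ x′≈0 → x≉0 (trans x≈x′ x′≈0)) , y , y≉0 ,
    λ r → trans (*-congʳ (*-congʳ (sym x≈x′))) (x⟂y r)

  Adjacent-congˡ : ∀ {x x′ y} → x ≈ x′ → Adjacent R x y → Adjacent R x′ y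
  Adjacent-congˡ x≈x′ (vx , vy , x≉y , x⟂y) =
    IsVertex-cong x≈x′ vx , vy , (λ x′≈y → x≉y (trans x≈x′ x′≈y)) , ⟂-congˡ x≈x′ x⟂y

  neighbour-VertexExcept : ∀ {a y y′} → y ≈ a → Adjacent R y y′ → VertexExcept R a y′
  neighbour-VertexExcept y≈a (_ , vy′ , y≉y′ , _) = vy′ , λ y′≈a → y≉y′ (trans y≈a (sym y′≈a))

  module _ {P : Carrier → Set (c ⊔ ℓ)} where

    WalkIn-endCong : ∀ {x y y′} → WalkIn R P x y → y ≈ y′ → WalkIn R P x y′
    WalkIn-endCong (nil px x≈y) y≈y′ = nil px (trans x≈y y≈y′)
    WalkIn-endCong (cons px x~z W) y≈y′ = cons px x~z (WalkIn-endCong W y≈y′)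

    WalkIn-startCong : ∀ {x x′ y} → x ≈ x′ → P x → WalkIn R P x′ y → WalkIn R P x y
    WalkIn-startCong x≈x′ px (nil _ x′≈y) = nil px (trans x≈x′ x′≈y)
    WalkIn-startCong x≈x′ px (cons _ x′~z W) = cons px (Adjacent-congˡ (sym x≈x′) x′~z) W

    infixr 5 _++ʷ_
    _++ʷ_ : ∀ {x y z} → WalkIn R P x y → WalkIn R P y z → WalkIn R P x z
    nil px x≈y ++ʷ V = WalkIn-startCong x≈y px V
    cons px x~w W ++ʷ V = cons px x~w (W ++ʷ V)

  infix 4 _≤_
  _≤_ : Carrier → Carrier → Set ℓ
  _≤_ = _≤CP_ R

  ≤-refl : ∀ {e} → e * e ≈ e → e ≤ e
  ≤-refl ee≈e = sym ee≈e , sym ee≈e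

  ≤-trans : ∀ {e f g} → e ≤ f → f ≤ g → e ≤ g
  ≤-trans {e} {f} {g} (e≈ef , e≈fe) (f≈fg , f≈gf) =
    (begin
      e            ≈⟨ e≈ef ⟩
      e * f        ≈⟨ *-congˡ f≈fg ⟩
      e * (f * g)  ≈⟨ *-assoc e f g ⟨
      (e * f) * g  ≈⟨ *-congʳ e≈ef ⟨
      e * g        ∎) ,
    (begin
      e            ≈⟨ e≈fe ⟩
      f * e        ≈⟨ *-congʳ f≈gf ⟩
      (g * f) * e  ≈⟨ *-assoc g f e ⟩
      g * (f * e)  ≈⟨ *-congˡ e≈fe ⟨
      g * e        ∎)

  ≤-congʳ : ∀ {e f f′} → f ≈ f′ → e ≤ f → e ≤ f′
  ≤-congʳ f≈f′ (e≈ef , e≈fe) = trans e≈ef (*-congˡ f≈f′) , trans e≈fe (*-congʳ f≈f′)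

  *-≤ˡ : ∀ {e f} → e * f ≈ f * e → e * e ≈ e → e * f ≤ e
  *-≤ˡ {e} {f} ef≈fe ee≈e =
    (begin
      e * f        ≈⟨ e*f≈e*[e*f] ⟩
      e * (e * f)  ≈⟨ *-congˡ ef≈fe ⟩
      e * (f * e)  ≈⟨ *-assoc e f e ⟨
      (e * f) * e  ∎) ,
    e*f≈e*[e*f]
    where
    e*f≈e*[e*f] : e * f ≈ e * (e * f)
    e*f≈e*[e*f] = trans (*-congʳ (sym ee≈e)) (*-assoc e e f)

  *-≤ʳ : ∀ {e f} → e * f ≈ f * e → f * f ≈ f → e * f ≤ f
  *-≤ʳ {e} {f} ef≈fe ff≈f =
    (begin
      e * f        ≈⟨ *-congˡ ff≈f ⟨
      e * (f * f)  ≈⟨ *-assoc e f f ⟨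
      (e * f) * f  ∎) ,
    (begin
      e * f        ≈⟨ *-congˡ ff≈f ⟨
      e * (f * f)  ≈⟨ *-assoc e f f ⟨
      (e * f) * f  ≈⟨ *-congʳ ef≈fe ⟩
      (f * e) * f  ≈⟨ *-assoc f e f ⟩
      f * (e * f)  ∎)

  IsCentralProjection-cong : ∀ {e e′} → e ≈ e′ → IsCentralProjection R e → IsCentralProjection R e′
  IsCentralProjection-cong e≈e′ ((ee≈e , e⋆≈e) , e-central) =
    (trans (*-cong (sym e≈e′) (sym e≈e′)) (trans ee≈e e≈e′) ,
     trans (⋆-cong (sym e≈e′)) (trans e⋆≈e e≈e′)) ,
    λ x → trans (*-congʳ (sym e≈e′)) (trans (e-central x) (*-congˡ e≈e′))

  *-isCentralProjection : ∀ {e f} → IsCentralProjection R e → IsCentralProjection R f →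
    IsCentralProjection R (e * f)
  *-isCentralProjection {e} {f} ((ee≈e , e⋆≈e) , e-central) ((ff≈f , f⋆≈f) , f-central) =
    (ef-idem , ef-selfAdjoint) , ef-central
    where
    ef-idem : (e * f) * (e * f) ≈ e * f
    ef-idem = begin
      (e * f) * (e * f)  ≈⟨ *-assoc (e * f) e f ⟨
      ((e * f) * e) * f  ≈⟨ *-congʳ (proj₁ (*-≤ˡ (e-central f) ee≈e)) ⟨
      (e * f) * f        ≈⟨ proj₁ (*-≤ʳ (e-central f) ff≈f) ⟨
      e * f              ∎
    ef-selfAdjoint : ((e * f) ⋆) ≈ e * f
    ef-selfAdjoint = begin
      (e * f) ⋆        ≈⟨ ⋆-* e f ⟩
      (f ⋆) * (e ⋆)    ≈⟨ *-cong f⋆≈f e⋆≈e ⟩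
      f * e            ≈⟨ e-central f ⟨
      e * f            ∎
    ef-central : ∀ x → (e * f) * x ≈ x * (e * f)
    ef-central x = begin
      (e * f) * x      ≈⟨ *-assoc e f x ⟩
      e * (f * x)      ≈⟨ *-congˡ (f-central x) ⟩
      e * (x * f)      ≈⟨ *-assoc e x f ⟨
      (e * x) * f      ≈⟨ *-congʳ (e-central x) ⟩
      (x * e) * f      ≈⟨ *-assoc x e f ⟩
      x * (e * f)      ∎

  IsRightAnnihilatorProjection : Carrier → Carrier → Set (c ⊔ ℓ)
  IsRightAnnihilatorProjection z e = IsProjection R e ×
    (∀ x → (InRightAnnOfIdeal R z x → Σ Carrier λ y → x ≈ e * y)
         × (Σ Carrier (λ y → x ≈ e * y) → InRightAnnOfIdeal R z x))

  InRightAnnOfIdeal-*ˡ : ∀ {z x} s → InRightAnnOfIdeal R z x → InRightAnnOfIdeal R z (s * x)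
  InRightAnnOfIdeal-*ˡ {z} {x} s x∈ann t = begin
    (z * t) * (s * x)  ≈⟨ *-assoc (z * t) s x ⟨
    ((z * t) * s) * x  ≈⟨ *-congʳ (*-assoc z t s) ⟩
    (z * (t * s)) * x  ≈⟨ x∈ann (t * s) ⟩
    0#                 ∎

  module _ {z e} (e-gen : IsRightAnnihilatorProjection z e) where
    private
      ee≈e : e * e ≈ e
      ee≈e = proj₁ (proj₁ e-gen)
      e⋆≈e : (e ⋆) ≈ e
      e⋆≈e = proj₂ (proj₁ e-gen)

    annProj∈rightAnn : InRightAnnOfIdeal R z e
    annProj∈rightAnn = proj₂ (proj₂ e-gen e) (e , sym ee≈e)

    annProj-fixes : ∀ {x} → InRightAnnOfIdeal R z x → e * x ≈ x
    annProj-fixes {x} x∈ann with proj₁ (proj₂ e-gen x) x∈ann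
    ... | y , x≈ey = begin
      e * x        ≈⟨ *-congˡ x≈ey ⟩
      e * (e * y)  ≈⟨ *-assoc e e y ⟨
      (e * e) * y  ≈⟨ *-congʳ ee≈e ⟩
      e * y        ≈⟨ x≈ey ⟨
      x            ∎

    annProj-leftSemicentral : ∀ s → (e * s) * e ≈ s * e
    annProj-leftSemicentral s =
      trans (*-assoc e s e) (annProj-fixes (InRightAnnOfIdeal-*ˡ s annProj∈rightAnn))

    annProj-isCentralProjection : IsCentralProjection R e
    annProj-isCentralProjection = proj₁ e-gen , central
      where
      -- a self-adjoint left semicentral idempotent is central: apply ⋆ to e s⋆ e = s⋆ e
      central : ∀ s → e * s ≈ s * e
      central s = begin
        e * s                    ≈⟨ *-cong e⋆≈e (⋆-invol s) ⟨
        (e ⋆) * ((s ⋆) ⋆)        ≈⟨ ⋆-* (s ⋆) e ⟨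
        ((s ⋆) * e) ⋆            ≈⟨ ⋆-cong (annProj-leftSemicentral (s ⋆)) ⟨
        ((e * (s ⋆)) * e) ⋆      ≈⟨ ⋆-* (e * (s ⋆)) e ⟩
        (e ⋆) * ((e * (s ⋆)) ⋆)  ≈⟨ *-cong e⋆≈e (⋆-* e (s ⋆)) ⟩
        e * (((s ⋆) ⋆) * (e ⋆))  ≈⟨ *-congˡ (*-cong (⋆-invol s) e⋆≈e) ⟩
        e * (s * e)              ≈⟨ *-assoc e s e ⟨
        (e * s) * e              ≈⟨ annProj-leftSemicentral s ⟩
        s * e                    ∎

  rightAnn-≤⇒⟂ : ∀ {p e h} → InRightAnnOfIdeal R p e → (h ⋆) ≈ h → h ≤ e → p ⟂ h
  rightAnn-≤⇒⟂ {p} {e} {h} e∈ann h⋆≈h (_ , h≈eh) r = begin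
    (p * r) * (h ⋆)    ≈⟨ *-congˡ (trans h⋆≈h h≈eh) ⟩
    (p * r) * (e * h)  ≈⟨ *-assoc (p * r) e h ⟨
    ((p * r) * e) * h  ≈⟨ *-congʳ (e∈ann r) ⟩
    0# * h             ≈⟨ zeroˡ h ⟩
    0#                 ∎

  rightAnn-≤⇒≉ : ∀ {p e h} → InRightAnnOfIdeal R p e → ¬ h ≈ 0# → h ≤ e → ¬ p ≈ h
  rightAnn-≤⇒≉ {p} {e} {h} e∈ann h≉0 (h≈he , _) p≈h = h≉0 (begin
    h             ≈⟨ h≈he ⟩
    h * e         ≈⟨ *-congʳ p≈h ⟨
    p * e         ≈⟨ *-congʳ (*-identityʳ p) ⟨
    (p * 1#) * e  ≈⟨ e∈ann 1# ⟩
    0#            ∎)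

  rightAnn-≤⇒Adjacent : ∀ {p e h} → InRightAnnOfIdeal R p e → ¬ p ≈ 0# → ¬ h ≈ 0# →
    (h ⋆) ≈ h → h ≤ e → Adjacent R p h
  rightAnn-≤⇒Adjacent e∈ann p≉0 h≉0 h⋆≈h h≤e =
    ⟂⇒Adjacent p≉0 h≉0 (rightAnn-≤⇒≉ e∈ann h≉0 h≤e) (rightAnn-≤⇒⟂ e∈ann h⋆≈h h≤e)

  rightAnn-≤⇒walk : ∀ {a p q e f h} → InRightAnnOfIdeal R p e → InRightAnnOfIdeal R q f →
    VertexExcept R a p → VertexExcept R a q → ¬ h ≈ 0# → ¬ h ≈ a → (h ⋆) ≈ h →
    h ≤ e → h ≤ f → WalkIn R (VertexExcept R a) p q
  rightAnn-≤⇒walk {p = p} {q} {h = h} e∈ann f∈ann p∉ q∉ h≉0 h≉a h⋆≈h h≤e h≤f =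
    cons p∉ p~h (cons (proj₁ (proj₂ p~h) , h≉a) (Adjacent-sym q~h) (nil q∉ refl))
    where
    p~h : Adjacent R p h
    p~h = rightAnn-≤⇒Adjacent e∈ann (proj₁ (proj₁ p∉)) h≉0 h⋆≈h h≤e
    q~h : Adjacent R q h
    q~h = rightAnn-≤⇒Adjacent f∈ann (proj₁ (proj₁ q∉)) h≉0 h⋆≈h h≤f

  SeparatedNeighbours : Carrier → Set (c ⊔ ℓ)
  SeparatedNeighbours a = Σ Carrier λ p → Σ Carrier λ q →
    VertexExcept R a p × VertexExcept R a q × p ⟂ a × q ⟂ a ×
    ¬ WalkIn R (VertexExcept R a) p q

  module _ (em : ExcludedMiddle (c ⊔ ℓ)) where

    _≈?_ : ∀ x y → Dec (x ≈ y)
    x ≈? y = map′ lower lift (em {Lift c (x ≈ y)})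

    module _ {a u : Carrier} where
      private
        Reachable : Carrier → Set (c ⊔ ℓ)
        Reachable = WalkIn R (VertexExcept R a) u

      -- Follow the walk while u reaches its current vertex in Γ − a; reachability
      -- can only be lost on a step x — a — y′, and then x, y′ are separated.
      separatedNeighbours-along : ∀ {x w} → WalkIn R (IsVertex R) x w →
        VertexExcept R a x → ¬ w ≈ a → Reachable x → ¬ Reachable w → SeparatedNeighbours a
      separatedNeighbours-via : ∀ {x y w} → x ⟂ y → y ≈ a → WalkIn R (IsVertex R) y w →
        VertexExcept R a x → ¬ w ≈ a → Reachable x → ¬ Reachable w → SeparatedNeighbours a

      separatedNeighbours-along (nil _ x≈w) _ _ ux ¬uw = ⊥-elim (¬uw (WalkIn-endCong ux x≈w))
      separatedNeighbours-along (cons {y = y} _ x~y@(_ , vy , _ , x⟂y) W) x∉ w≉a ux ¬uw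
        with y ≈? a
      ... | yes y≈a = separatedNeighbours-via x⟂y y≈a W x∉ w≉a ux ¬uw
      ... | no y≉a = separatedNeighbours-along W (vy , y≉a) w≉a
                       (ux ++ʷ cons x∉ x~y (nil (vy , y≉a) refl)) ¬uw

      separatedNeighbours-via _ y≈a (nil _ y≈w) _ w≉a _ _ = ⊥-elim (w≉a (trans (sym y≈w) y≈a))
      separatedNeighbours-via {x} x⟂y y≈a (cons {y = y′} _ y~y′@(_ , _ , _ , y⟂y′) W) x∉ w≉a ux ¬uw
        with em {Reachable y′}
      ... | yes uy′ = separatedNeighbours-along W (neighbour-VertexExcept y≈a y~y′) w≉a uy′ ¬uw
      ... | no ¬uy′ = x , y′ , x∉ , neighbour-VertexExcept y≈a y~y′ ,
                      ⟂-congʳ y≈a x⟂y , ⟂-sym (⟂-congˡ y≈a y⟂y′) ,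
                      λ xy′ → ¬uy′ (ux ++ʷ xy′)

    cutVertex⇒separatedNeighbours : ∀ {a} → IsCutVertex R a → SeparatedNeighbours a
    cutVertex⇒separatedNeighbours (_ , _ , _ , u∉ , (_ , w≉a) , W , ¬uw) =
      separatedNeighbours-along W u∉ w≉a (nil u∉ refl) ¬uw

    onlyNonzeroBelow⇒atom : ∀ {a g} → IsCentralProjection R g → ¬ g ≈ 0# →
      (∀ {h} → ¬ h ≈ 0# → (h ⋆) ≈ h → h ≤ g → h ≈ a) →
      IsCentralProjection R a × IsAtomCP R a
    onlyNonzeroBelow⇒atom {a} {g} g-cp g≉0 below-g = a-cp , a-cp , a≉0 , below-a
      where
      g≈a : g ≈ a
      g≈a = below-g g≉0 (proj₂ (proj₁ g-cp)) (≤-refl (proj₁ (proj₁ g-cp)))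

      a-cp : IsCentralProjection R a
      a-cp = IsCentralProjection-cong g≈a g-cp

      a≉0 : ¬ a ≈ 0#
      a≉0 a≈0 = g≉0 (trans g≈a a≈0)

      below-a : ∀ h → IsCentralProjection R h → h ≤ a → (h ≈ 0#) ⊎ (h ≈ a)
      below-a h ((_ , h⋆≈h) , _) h≤a with h ≈? 0#
      ... | yes h≈0 = inj₁ h≈0
      ... | no h≉0 = inj₂ (below-g h≉0 h⋆≈h (≤-congʳ (sym g≈a) h≤a))

    separatedNeighbours⇒atom : IsPQBaer R → ∀ {a} → ¬ a ≈ 0# → SeparatedNeighbours a →
      IsCentralProjection R a × IsAtomCP R a
    separatedNeighbours⇒atom pq {a} a≉0 (p , q , p∉ , q∉ , p⟂a , q⟂a , ¬pq) =
      onlyNonzeroBelow⇒atom g-cp g≉0 below-g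
      where
      e f g : Carrier
      e = proj₁ (pq p)
      f = proj₁ (pq q)
      g = e * f

      e-gen : IsRightAnnihilatorProjection p e
      e-gen = proj₂ (pq p)
      f-gen : IsRightAnnihilatorProjection q f
      f-gen = proj₂ (pq q)

      e-cp : IsCentralProjection R e
      e-cp = annProj-isCentralProjection e-gen
      f-cp : IsCentralProjection R f
      f-cp = annProj-isCentralProjection f-gen
      g-cp : IsCentralProjection R g
      g-cp = *-isCentralProjection e-cp f-cp

      g≤e : g ≤ e
      g≤e = *-≤ˡ (proj₂ e-cp f) (proj₁ (proj₁ e-cp))
      g≤f : g ≤ f
      g≤f = *-≤ʳ (proj₂ e-cp f) (proj₁ (proj₁ f-cp))

      g≉0 : ¬ g ≈ 0#
      g≉0 g≈0 = ⋆-≉0 a≉0 (begin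
        a ⋆              ≈⟨ annProj-fixes e-gen p⟂a ⟨
        e * (a ⋆)        ≈⟨ *-congˡ (annProj-fixes f-gen q⟂a) ⟨
        e * (f * (a ⋆))  ≈⟨ *-assoc e f (a ⋆) ⟨
        g * (a ⋆)        ≈⟨ *-congʳ g≈0 ⟩
        0# * (a ⋆)       ≈⟨ zeroˡ (a ⋆) ⟩
        0#               ∎)

      below-g : ∀ {h} → ¬ h ≈ 0# → (h ⋆) ≈ h → h ≤ g → h ≈ a
      below-g {h} h≉0 h⋆≈h h≤g with h ≈? a
      ... | yes h≈a = h≈a
      ... | no h≉a = ⊥-elim (¬pq (rightAnn-≤⇒walk
                       (annProj∈rightAnn e-gen) (annProj∈rightAnn f-gen) p∉ q∉
                       h≉0 h≉a h⋆≈h (≤-trans h≤g g≤e) (≤-trans h≤g g≤f)))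

theorem3p4 : ∀ {c ℓ} → ExcludedMiddle (c ⊔ ℓ) → (R : StarRing c ℓ) →
    IsPQBaer R → ∀ a → IsCutVertex R a →
    IsCentralProjection R a × IsAtomCP R a
theorem3p4 em R pq a a-cut =
  separatedNeighbours⇒atom R em pq (proj₁ (proj₁ a-cut)) (cutVertex⇒separatedNeighbours R em a-cut)
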